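{- For every $P\in\mathsf{nCSP}$ there is a normal form $N$ such that $P=_EN$.
   Context: Let $\mathsf{Act}$ be a finite set of actions. $\mathsf{nCSP}$ terms: $P::=S\mid P\oplus_pP$ ($0<p<1$), $S::=\mathbf 0\mid a.P\ (a\in\mathsf{Act})\mid P\sqcap P\mid S\Box S$, where $P\Box Q$ for non-state-based $P,Q$ abbreviates the term obtained by distributing $\Box$ over $\oplus_p$. Normal forms are generated by $N::=N_1\oplus_pN_2\mid N_1\sqcap N_2\mid\Box_{i\in I}a_i.N_i$ ($I$ finite; the empty external choice is $\mathbf 0$). $P=_EQ$ means $P=Q$ is derivable in equational logic (reflexivity, symmetry, transitivity, substitution instances, closure under all operators) from: (P1) $P\oplus_pP=P$; (P2) $P\oplus_pQ=Q\oplus_{1-p}P$; (P3) $(P\oplus_pQ)\oplus_qR=P\oplus_{p\cdot q}(Q\oplus_{\frac{(1-p)q}{1-pq}}R)$; (I1) $P\sqcap P=P$; (I2) $P\sqcap Q=Q\sqcap P$; (I3) $(P\sqcap Q)\sqcap R=P\sqcap(Q\sqcap R)$; (E1) $P\Box\mathbf 0=P$; (E2) $P\Box Q=Q\Box P$; (E3) $(P\Box Q)\Box R=P\Box(Q\Box R)$; (EI) $a.P\Box a.Q=a.P\sqcap a.Q$; (D1) $P\Box(Q\oplus_pR)=(P\Box Q)\oplus_p(P\Box R)$; (D2) $a.P\Box(Q\sqcap R)=(a.P\Box Q)\sqcap(a.P\Box R)$; (D3) $(P_1\sqcap P_2)\Box(Q_1\sqcap Q_2)=(P_1\Box(Q_1\sqcap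 Q_2))\sqcap(P_2\Box(Q_1\sqcap Q_2))\sqcap((P_1\sqcap P_2)\Box Q_1)\sqcap((P_1\sqcap P_2)\Box Q_2)$.
   Formalization: The probability weights p of $P\oplus_pP$, both in nCSP terms and in normal forms, are rational numbers. -}

module Defs where

open import Data.Nat using (ℕ)
open import Data.Fin using (Fin)
open import Data.Rational using (ℚ; 0ℚ; 1ℚ; _*_; _-_; _<_)
open import Data.Product using (_×_; _,_; proj₁; proj₂)
open import Data.List using (List; []; _∷_)
open import Data.List.Relation.Unary.All using (All)
open import Relation.Binary.PropositionalEquality using (_≡_)

Proper : ℚ → Set
Proper p = (0ℚ < p) × (p < 1ℚ)

module _ (n : ℕ) where
  Act : Set
  Act = Fin n

  infixr 6 _□_
  infixr 5 _⊓_
  infixr 4 _⊕[_]_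
  infixr 7 _∙_

  -- Raw (single-sorted) term syntax with all operators of nCSP.
  data Term : Set where
    𝟎      : Term
    _∙_    : Act → Term → Term
    _⊓_    : Term → Term → Term
    _□_    : Term → Term → Term
    _⊕[_]_ : Term → ℚ → Term → Term

  -- The two-sorted grammar of nCSP:
  --   P ::= S | P ⊕_p P   (0<p<1)
  --   S ::= 0 | a.P | P ⊓ P | S □ S
  mutual
    data IsP : Term → Set where
      p-state : ∀ {t} → IsS t → IsP t
      p-⊕     : ∀ {t u p} → Proper p → IsP t → IsP u → IsP (t ⊕[ p ] u)

    data IsS : Term → Set where
      s-𝟎 : IsS 𝟎
      s-∙ : ∀ {a t} → IsP t → IsS (a ∙ t)
      s-⊓ : ∀ {t u} → IsP t → IsP u → IsS (t ⊓ u)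
      s-□ : ∀ {t u} → IsS t → IsS u → IsS (t □ u)

  ExtChoice : List (Act × Term) → Term
  ExtChoice []                = 𝟎
  ExtChoice ((a , t) ∷ [])    = a ∙ t
  ExtChoice ((a , t) ∷ x ∷ xs) = (a ∙ t) □ ExtChoice (x ∷ xs)

  data IsNF : Term → Set where
    nf-⊕   : ∀ {t u p} → Proper p → IsNF t → IsNF u → IsNF (t ⊕[ p ] u)
    nf-⊓   : ∀ {t u} → IsNF t → IsNF u → IsNF (t ⊓ u)
    nf-ext : (xs : List (Act × Term)) → All (λ x → IsNF (proj₂ x)) xs →
             IsNF (ExtChoice xs)

  infix 3 _=E_
  data _=E_ : Term → Term → Set where
    e-refl  : ∀ {t} → t =E t
    e-sym   : ∀ {t u} → t =E u → u =E t
    e-trans : ∀ {t u v} → t =E u → u =E v → t =E v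
    c-∙ : ∀ {a t t'} → t =E t' → a ∙ t =E a ∙ t'
    c-⊓ : ∀ {t t' u u'} → t =E t' → u =E u' → t ⊓ u =E t' ⊓ u'
    c-□ : ∀ {t t' u u'} → t =E t' → u =E u' → t □ u =E t' □ u'
    c-⊕ : ∀ {t t' u u' p} → t =E t' → u =E u' → t ⊕[ p ] u =E t' ⊕[ p ] u'
    P1 : ∀ {p} P → Proper p → P ⊕[ p ] P =E P
    P2 : ∀ {p} P Q → Proper p → P ⊕[ p ] Q =E Q ⊕[ 1ℚ - p ] P
    -- (P3) with r = p·q and s = (1-p)q/(1-pq), i.e. s·(1-pq) = (1-p)q
    P3 : ∀ {p q r s} P Q R → Proper p → Proper q →
         r ≡ p * q → s * (1ℚ - p * q) ≡ (1ℚ - p) * q →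
         (P ⊕[ p ] Q) ⊕[ q ] R =E P ⊕[ r ] (Q ⊕[ s ] R)
    I1 : ∀ P → P ⊓ P =E P
    I2 : ∀ P Q → P ⊓ Q =E Q ⊓ P
    I3 : ∀ P Q R → (P ⊓ Q) ⊓ R =E P ⊓ (Q ⊓ R)
    E1 : ∀ P → P □ 𝟎 =E P
    E2 : ∀ P Q → P □ Q =E Q □ P
    E3 : ∀ P Q R → (P □ Q) □ R =E P □ (Q □ R)
    EI : ∀ a P Q → (a ∙ P) □ (a ∙ Q) =E (a ∙ P) ⊓ (a ∙ Q)
    D1 : ∀ {p} P Q R → Proper p → P □ (Q ⊕[ p ] R) =E (P □ Q) ⊕[ p ] (P □ R)
    D2 : ∀ a P Q R → (a ∙ P) □ (Q ⊓ R) =E ((a ∙ P) □ Q) ⊓ ((a ∙ P) □ R)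
    D3 : ∀ P₁ P₂ Q₁ Q₂ →
         (P₁ ⊓ P₂) □ (Q₁ ⊓ Q₂) =E
         (P₁ □ (Q₁ ⊓ Q₂)) ⊓ ((P₂ □ (Q₁ ⊓ Q₂)) ⊓
           (((P₁ ⊓ P₂) □ Q₁) ⊓ ((P₁ ⊓ P₂) □ Q₂)))

module Submission where

-- The only real work is external choice: we show that
-- N □ M has a normal form whenever N and M are normal forms, by pushing □
-- inwards with the distributive laws:
--   * (D1) moves □ under ⊕_p on either side (using E2 for the left side);
--   * a.K □ M is normalised by induction on M, using D1, D2, E1 and the fact
--     that a.K □ (□_i a_i.N_i) is again an external choice of prefixes;
--   * (□_i a_i.N_i) □ M follows by peeling off one prefix at a time (E3);
--   * (N₁ ⊓ N₂) □ (M₁ ⊓ M₂) is split by D3 into four smaller choices.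
-- The last step recurses lexicographically on the pair of normal forms.

open import Defs
open import Data.Nat using (ℕ)
open import Data.Product using (Σ; _×_; _,_; proj₂)
open import Data.List using (List; []; _∷_)
open import Data.List.Relation.Unary.All using (All; []; _∷_)
open import Relation.Binary.Bundles using (Setoid)

module _ {n : ℕ} where

  private
    T : Set
    T = Term n

    _≈_ : T → T → Set
    _≈_ = _=E_ n

    infix 3 _≈_

  =E-setoid : Setoid _ _
  =E-setoid = record
    { Carrier = T
    ; _≈_ = _≈_
    ; isEquivalence = record { refl = e-refl ; sym = e-sym ; trans = e-trans }
    }

  open import Relation.Binary.Reasoning.Setoid =E-setoid

  AllNF : List (Act n × T) → Set
  AllNF = All (λ x → IsNF n (proj₂ x))

  HasNF : T → Set
  HasNF t = Σ T (λ N → IsNF n N × t ≈ N)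

  nf-self : ∀ {N} → IsNF n N → HasNF N
  nf-self f = _ , f , e-refl

  nf-resp : ∀ {t u} → t ≈ u → HasNF u → HasNF t
  nf-resp t≈u (N , f , u≈N) = N , f , e-trans t≈u u≈N

  nf-⊕ᴱ : ∀ {t u p} → Proper p → HasNF t → HasNF u → HasNF (t ⊕[ p ] u)
  nf-⊕ᴱ p (N , f , e) (M , g , d) = (N ⊕[ _ ] M) , nf-⊕ p f g , c-⊕ e d

  nf-⊓ᴱ : ∀ {t u} → HasNF t → HasNF u → HasNF (t ⊓ u)
  nf-⊓ᴱ (N , f , e) (M , g , d) = N ⊓ M , nf-⊓ f g , c-⊓ e d

  nf-∙ᴱ : ∀ a {t} → HasNF t → HasNF (_∙_ {n} a t)
  nf-∙ᴱ a (N , f , e) = _ , nf-ext ((a , N) ∷ []) (f ∷ []) , c-∙ e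

  D1ˡ : ∀ {p} P Q R → Proper p → (Q ⊕[ p ] R) □ P ≈ (Q □ P) ⊕[ p ] (R □ P)
  D1ˡ P Q R p = begin
    (Q ⊕[ _ ] R) □ P         ≈⟨ E2 _ P ⟩
    P □ (Q ⊕[ _ ] R)         ≈⟨ D1 P Q R p ⟩
    (P □ Q) ⊕[ _ ] (P □ R)   ≈⟨ c-⊕ (E2 P Q) (E2 P R) ⟩
    (Q □ P) ⊕[ _ ] (R □ P)   ∎

  prefix□ : ∀ a {K M} → IsNF n K → IsNF n M → HasNF ((_∙_ {n} a K) □ M)
  prefix□ a k (nf-⊕ p m₁ m₂) =
    nf-resp (D1 _ _ _ p) (nf-⊕ᴱ p (prefix□ a k m₁) (prefix□ a k m₂))
  prefix□ a k (nf-⊓ m₁ m₂) =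
    nf-resp (D2 a _ _ _) (nf-⊓ᴱ (prefix□ a k m₁) (prefix□ a k m₂))
  prefix□ a {K} k (nf-ext [] []) =
    nf-resp (E1 _) (nf-self (nf-ext ((a , K) ∷ []) (k ∷ [])))
  prefix□ a {K} k (nf-ext (x ∷ xs) ks) =
    nf-self (nf-ext ((a , K) ∷ x ∷ xs) (k ∷ ks))

  ext□ : ∀ xs → AllNF xs → ∀ {M} → IsNF n M → HasNF (ExtChoice n xs □ M)
  ext□ [] [] m = nf-resp (e-trans (E2 _ _) (E1 _)) (nf-self m)
  ext□ ((a , K) ∷ []) (k ∷ []) m = prefix□ a k m
  ext□ ((a , K) ∷ y ∷ ys) (k ∷ ks) m with ext□ (y ∷ ys) ks m
  ... | N , f , rest≈N =
    nf-resp (e-trans (E3 _ _ _) (c-□ e-refl rest≈N)) (prefix□ a k f)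

  -- The external choice of two normal forms has a normal form.  Recursion
  -- is lexicographic: first on N, then on M (in the case N = N₁ ⊓ N₂).
  nf□ : ∀ {N M} → IsNF n N → IsNF n M → HasNF (N □ M)
  nf□ (nf-⊕ p n₁ n₂) m = nf-resp (D1ˡ _ _ _ p) (nf-⊕ᴱ p (nf□ n₁ m) (nf□ n₂ m))
  nf□ (nf-ext xs ks) m = ext□ xs ks m
  nf□ n@(nf-⊓ _ _) (nf-⊕ p m₁ m₂) =
    nf-resp (D1 _ _ _ p) (nf-⊕ᴱ p (nf□ n m₁) (nf□ n m₂))
  nf□ n@(nf-⊓ _ _) (nf-ext ys ks) = nf-resp (E2 _ _) (ext□ ys ks n)
  nf□ n@(nf-⊓ n₁ n₂) m@(nf-⊓ m₁ m₂) =
    nf-resp (D3 _ _ _ _)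
      (nf-⊓ᴱ (nf□ n₁ m) (nf-⊓ᴱ (nf□ n₂ m) (nf-⊓ᴱ (nf□ n m₁) (nf□ n m₂))))

  nf-□ᴱ : ∀ {t u} → HasNF t → HasNF u → HasNF (t □ u)
  nf-□ᴱ (N , f , e) (M , g , d) = nf-resp (c-□ e d) (nf□ f g)

  mutual
    normaliseP : ∀ {t} → IsP n t → HasNF t
    normaliseP (p-state s) = normaliseS s
    normaliseP (p-⊕ p a b) = nf-⊕ᴱ p (normaliseP a) (normaliseP b)

    normaliseS : ∀ {t} → IsS n t → HasNF t
    normaliseS s-𝟎         = nf-self (nf-ext [] [])
    normaliseS (s-∙ {a} x) = nf-∙ᴱ a (normaliseP x)
    normaliseS (s-⊓ a b)   = nf-⊓ᴱ (normaliseP a) (normaliseP b)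
    normaliseS (s-□ a b)   = nf-□ᴱ (normaliseS a) (normaliseS b)

proposition9p3 : (n : ℕ) (P : Term n) → IsP n P →
    Σ (Term n) (λ N → IsNF n N × (_=E_ n P N))
proposition9p3 n P p = normaliseP p
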